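{- Let $G$ be a plane graph and $v\in V(G)$ with $d_G(v)\geq 7$. Then $w_G(v)\leq 3(d_G(v)-4)$.
   Context: All graphs are finite and simple. In a plane graph, a $k$-face is a face of length $k$ (length = number of edges on its boundary walk, a cut edge counted twice), a $4^+$-face is a face of length at least $4$, and two faces are adjacent if they share an edge. A diamond is a configuration of two adjacent $3$-faces sharing exactly one edge; this common edge is its mid-edge. A diamond is incident to a vertex $v$ if its mid-edge is incident to $v$. A diamond incident to $v$ is a special diamond (at $v$) if some edge of the diamond incident to $v$, other than the mid-edge, is also incident to a $4^+$-face. $w^t_G(v)$ is the number of $3$-faces incident to $v$, $w^d_G(v)$ is the number of special diamonds incident to $v$, and $w_G(v)=w^t_G(v)+w^d_G(v)$. -}

module Defs where

open import Data.Nat using (ℕ; zero; suc; _+_; _*_; _≡ᵇ_; _≤ᵇ_; _<ᵇ_)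
open import Data.Fin using (Fin; toℕ; _≟_)
open import Data.Bool using (Bool; true; false; if_then_else_; _∧_; _∨_; not)
open import Data.List using (List; []; _∷_; allFin; cartesianProduct)
open import Data.Bool.ListAction using (any)
open import Data.Product using (Σ; ∃; ∃-syntax; _×_; _,_)
open import Relation.Nullary using (¬_; does)
open import Relation.Binary.PropositionalEquality using (_≡_; _≢_)

iter : ∀ {A : Set} → (A → A) → ℕ → A → A
iter f zero    x = x
iter f (suc k) x = f (iter f k x)

count : ∀ {A : Set} → (A → Bool) → List A → ℕ
count p []       = 0
count p (x ∷ xs) = if p x then suc (count p xs) else count p xs

_==_ : ∀ {n} → Fin n → Fin n → Bool
x == y = does (x ≟ y)

Surjective : ∀ {n m} → (Fin n → Fin m) → Set
Surjective {n} {m} f = (j : Fin m) → ∃[ i ] f i ≡ j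

IsOrbitLabelling : ∀ {n m} → (Fin n → Fin n) → (Fin n → Fin m) → Set
IsOrbitLabelling {n} f lab =
  ((x : Fin n) (k : ℕ) → lab (iter f k x) ≡ lab x) ×
  ((x y : Fin n) → lab x ≡ lab y → ∃[ k ] iter f k x ≡ y) ×
  Surjective lab

data Linked {n} (σ α : Fin n → Fin n) : Fin n → Fin n → Set where
  lrefl  : ∀ {x} → Linked σ α x x
  lσ     : ∀ {x} → Linked σ α x (σ x)
  lα     : ∀ {x} → Linked σ α x (α x)
  lsym   : ∀ {x y} → Linked σ α x y → Linked σ α y x
  ltrans : ∀ {x y z} → Linked σ α x y → Linked σ α y z → Linked σ α x z

data LinkedB {n k} (σ α : Fin n → Fin n) (lab : Fin n → Fin k) : Fin n → Fin n → Set where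
  brefl  : ∀ {x} → LinkedB σ α lab x x
  bσ     : ∀ {x} → LinkedB σ α lab x (σ x)
  bα     : ∀ {x} → LinkedB σ α lab x (α x)
  blab   : ∀ {x y} → lab x ≡ lab y → LinkedB σ α lab x y
  bsym   : ∀ {x y} → LinkedB σ α lab x y → LinkedB σ α lab y x
  btrans : ∀ {x y z} → LinkedB σ α lab x y → LinkedB σ α lab y z → LinkedB σ α lab x z

-- Plane graphs, as combinatorial maps (rotation systems).
-- Darts: Fin n.  α : dart ↦ reverse dart.  σ : dart ↦ next dart (in the
-- rotation) at the same tail vertex.  φ = σ ∘ α traces facial boundary walks.
-- Every component is embedded in the sphere (Euler genus 0), and the
-- components are arranged in the plane: a plane face is a union of
-- component-faces (faceOf), the incidence multigraph
--   components — plane faces  (edges = component faces)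
-- being a tree.  Isolated vertices are omitted (they contribute nothing to
-- face lengths, nor to w).

record PlaneGraph (n : ℕ) : Set where
  field
    σ  : Fin n → Fin n
    σ⁻ : Fin n → Fin n
    σσ⁻ : ∀ x → σ (σ⁻ x) ≡ x
    σ⁻σ : ∀ x → σ⁻ (σ x) ≡ x
    α  : Fin n → Fin n
    αα : ∀ x → α (α x) ≡ x
    α-nofix : ∀ x → α x ≢ x

    nV : ℕ
    vertexOf : Fin n → Fin nV
    vertexOf-orb : IsOrbitLabelling σ vertexOf

    nFc : ℕ
    cfaceOf : Fin n → Fin nFc
    cfaceOf-orb : IsOrbitLabelling (λ x → σ (α x)) cfaceOf

    nC : ℕ
    compOf : Fin n → Fin nC
    compOf-σ : ∀ x → compOf (σ x) ≡ compOf x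
    compOf-α : ∀ x → compOf (α x) ≡ compOf x
    compOf-conn : ∀ x y → compOf x ≡ compOf y → Linked σ α x y
    compOf-surj : Surjective compOf

    -- every component has Euler genus 0:  V - E + F = 2 c  (E = n / 2)
    euler : 2 * nV + 2 * nFc ≡ n + 4 * nC

    noLoop  : ∀ x → vertexOf (α x) ≢ vertexOf x
    noMulti : ∀ x y → vertexOf x ≡ vertexOf y → vertexOf (α x) ≡ vertexOf (α y) → x ≡ y

    nF : ℕ
    faceOf : Fin n → Fin nF
    faceOf-cf : ∀ x y → cfaceOf x ≡ cfaceOf y → faceOf x ≡ faceOf y
    faceOf-surj : Surjective faceOf
    faceOf-conn : ∀ x y → LinkedB σ α faceOf x y
    faceOf-tree : nC + nF ≡ nFc + 1

module _ {n : ℕ} (G : PlaneGraph n) where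
  open PlaneGraph G

  darts : List (Fin n)
  darts = allFin n

  deg : Fin nV → ℕ
  deg u = count (λ x → vertexOf x == u) darts

  faceLen : Fin nF → ℕ
  faceLen f = count (λ x → faceOf x == f) darts

  is3face : Fin nF → Bool
  is3face f = faceLen f ≡ᵇ 3

  is4+face : Fin nF → Bool
  is4+face f = 4 ≤ᵇ faceLen f

  edgeOnFace : Fin n → Fin nF → Bool
  edgeOnFace x f = (faceOf x == f) ∨ (faceOf (α x) == f)

  edgeAtVertex : Fin n → Fin nV → Bool
  edgeAtVertex x u = (vertexOf x == u) ∨ (vertexOf (α x) == u)

  edgeOn4+ : Fin n → Bool
  edgeOn4+ x = is4+face (faceOf x) ∨ is4+face (faceOf (α x))

  faceAtVertex : Fin nF → Fin nV → Bool
  faceAtVertex f u = any (λ x → (faceOf x == f) ∧ (vertexOf x == u)) darts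

  sharedEdge : Fin nF → Fin nF → Fin n → Bool
  sharedEdge f g x = edgeOnFace x f ∧ edgeOnFace x g

  -- f, g are two distinct 3-faces sharing exactly one edge
  -- (each edge corresponds to exactly two darts)
  isDiamond : Fin nF → Fin nF → Bool
  isDiamond f g = is3face f ∧ is3face g ∧ not (f == g)
                  ∧ (count (sharedEdge f g) darts ≡ᵇ 2)

  diamondAt : Fin nF → Fin nF → Fin nV → Bool
  diamondAt f g u = any (λ x → sharedEdge f g x ∧ edgeAtVertex x u) darts

  specialAt : Fin nF → Fin nF → Fin nV → Bool
  specialAt f g u =
    any (λ y → (edgeOnFace y f ∨ edgeOnFace y g) ∧ not (sharedEdge f g y)
               ∧ edgeAtVertex y u ∧ edgeOn4+ y) darts

  wt : Fin nV → ℕ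
  wt u = count (λ f → is3face f ∧ faceAtVertex f u) (allFin nF)

  -- diamonds are unordered pairs of faces: count pairs f < g
  wd : Fin nV → ℕ
  wd u = count (λ { (f , g) → (toℕ f <ᵇ toℕ g) ∧ isDiamond f g
                               ∧ diamondAt f g u ∧ specialAt f g u })
               (cartesianProduct (allFin nF) (allFin nF))

  w : Fin nV → ℕ
  w u = wt u + wd u

-- A dart x with tail v is the corner of the face faceOf x at v, between the edges of σ⁻ x
-- and x.  The corners at v split into A triangular and B other ones, and deg v = A + B.
-- Every 3-face at v has a corner at v, so wt ≤ A.  A special diamond at v is determined
-- by the dart x at v of its mid-edge, whose faces are the triangular corners x and σ x, so
-- wd ≤ A.  Its special edge is that of σ⁻ x or of σ x, whose other face is then the
-- non-triangular corner σ⁻ x or σ (σ x); charging the diamond there gives wd ≤ 2B.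
-- Finally w ≤ A + 2B ≤ deg + 2 if B ≤ 2 and w ≤ 2A ≤ 2 (deg − 3) otherwise, and both
-- are at most 3 (deg − 4) once deg ≥ 7.

module Submission where

open import Defs
open import Data.Nat using (ℕ; suc; _+_; _*_; _∸_; _≤_; _<_; z≤n; s≤s; _<ᵇ_; _≡ᵇ_; _≤ᵇ_)
open import Data.Nat.Properties hiding (_≟_)
open import Data.Nat.Tactic.RingSolver using (solve-∀)
open import Data.Fin using (Fin; toℕ; _≟_)
open import Data.Bool using (Bool; true; false; T; if_then_else_; _∧_; _∨_; not)
open import Data.Bool.Properties using (T-≡; T-not-≡; T-∧; T-∨; ∨-comm)
open import Data.List using (List; []; _∷_; _++_; map; allFin; cartesianProduct)
open import Data.List.Membership.Propositional using (_∈_)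
open import Data.List.Membership.Propositional.Properties
  using (∈-allFin; ∈-map⁺; ∈-++⁺ˡ; ∈-++⁺ʳ)
open import Data.List.Relation.Unary.All using ([]; _∷_; lookup)
open import Data.List.Relation.Unary.AllPairs using ([]; _∷_)
open import Data.List.Relation.Unary.Any using (here; there; satisfied)
open import Data.List.Relation.Unary.Any.Properties using (any⁻)
open import Data.List.Relation.Unary.Unique.Propositional using (Unique)
open import Data.List.Relation.Unary.Unique.Propositional.Properties
  using (allFin⁺; cartesianProduct⁺)
open import Data.Product using (∃-syntax; _×_; _,_; proj₁; proj₂)
open import Data.Product.Properties using (≡-dec)
open import Data.Sum using (_⊎_; inj₁; inj₂; [_,_]; swap) renaming (map to map-⊎)
open import Data.Empty using (⊥-elim)
open import Function using (_∘_; id)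
open import Function.Bundles using (module Equivalence)
open import Relation.Nullary using (¬_; Dec; does; yes; no)
open import Relation.Nullary.Decidable using (dec-true; dec-false)
open import Relation.Binary.Definitions using (DecidableEquality)
open import Relation.Binary.PropositionalEquality
  using (_≡_; _≢_; refl; sym; trans; cong; cong₂; subst)

open Equivalence using (to; from)

T-does⁻ : ∀ {P : Set} (P? : Dec P) → T (does P?) → P
T-does⁻ (yes p) _ = p
T-does⁻ (no _)  ()

T-does⁺ : ∀ {P : Set} (P? : Dec P) → P → T (does P?)
T-does⁺ P? p = from T-≡ (dec-true P? p)

T-not-does⁻ : ∀ {P : Set} (P? : Dec P) → T (not (does P?)) → ¬ P
T-not-does⁻ (no ¬p) _ = ¬p
T-not-does⁻ (yes _) ()

T-not-does⁺ : ∀ {P : Set} (P? : Dec P) → ¬ P → T (not (does P?))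
T-not-does⁺ P? ¬p = from T-not-≡ (dec-false P? ¬p)

==⇒≡ : ∀ {k} {a b : Fin k} → T (a == b) → a ≡ b
==⇒≡ {a = a} {b} = T-does⁻ (a ≟ b)

count-∧-split : ∀ {A : Set} (p r : A → Bool) xs →
                count p xs ≡ count (λ x → p x ∧ r x) xs + count (λ x → p x ∧ not (r x)) xs
count-∧-split p r [] = refl
count-∧-split p r (x ∷ xs) with p x | r x
... | true  | true  = cong suc (count-∧-split p r xs)
... | true  | false = trans (cong suc (count-∧-split p r xs)) (sym (+-suc _ _))
... | false | _     = count-∧-split p r xs

count-++ : ∀ {A : Set} (p : A → Bool) xs ys → count p (xs ++ ys) ≡ count p xs + count p ys
count-++ p []       ys = refl
count-++ p (x ∷ xs) ys with p x
... | true  = cong suc (count-++ p xs ys)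
... | false = count-++ p xs ys

count-map : ∀ {A B : Set} (p : B → Bool) (f : A → B) xs → count p (map f xs) ≡ count (p ∘ f) xs
count-map p f []       = refl
count-map p f (x ∷ xs) with p (f x)
... | true  = cong suc (count-map p f xs)
... | false = count-map p f xs

count-pos : ∀ {A : Set} (p : A → Bool) {x xs} → x ∈ xs → T (p x) → 1 ≤ count p xs
count-pos p {xs = y ∷ ys} x∈xs px with p y in py | x∈xs
... | true  | _          = s≤s z≤n
... | false | here refl  = ⊥-elim (subst T py px)
... | false | there x∈ys = count-pos p x∈ys px

-- Distinct elements of xs have disjoint h-fibres, so their chosen preimages are distinct.
surjection⇒count-≤ : ∀ {A B : Set} → DecidableEquality A → (h : B → A) {p : A → Bool} {q : B → Bool}
  {xs : List A} {ys : List B} → Unique xs →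
  (∀ {a} → a ∈ xs → T (p a) → ∃[ b ] b ∈ ys × T (q b) × h b ≡ a) →
  count p xs ≤ count q ys
surjection⇒count-≤ _≟_ h {xs = []} _ _ = z≤n
surjection⇒count-≤ {B = B} _≟_ h {p} {q} {x ∷ xs} {ys} (x∉xs ∷ unique) cover = begin
  count p (x ∷ xs)               ≤⟨ head+tail ⟩
  count onX ys + count offX ys   ≡⟨ count-∧-split q (λ b → does (h b ≟ x)) ys ⟨
  count q ys                     ∎
  where
  open ≤-Reasoning
  onX offX : B → Bool
  onX  b = q b ∧ does (h b ≟ x)
  offX b = q b ∧ not (does (h b ≟ x))

  tail : count p xs ≤ count offX ys
  tail = surjection⇒count-≤ _≟_ h unique cover′
    where
    cover′ : ∀ {a} → a ∈ xs → T (p a) → ∃[ b ] b ∈ ys × T (offX b) × h b ≡ a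
    cover′ a∈xs pa with b , b∈ys , qb , refl ← cover (there a∈xs) pa =
      b , b∈ys , from T-∧ (qb , T-not-does⁺ (h b ≟ x) (lookup x∉xs a∈xs ∘ sym)) , refl

  head+tail : count p (x ∷ xs) ≤ count onX ys + count offX ys
  head+tail with p x in px
  ... | false = ≤-trans tail (m≤n+m _ _)
  ... | true with b , b∈ys , qb , hb≡x ← cover (here refl) (subst T (sym px) _) =
    +-mono-≤ (count-pos onX b∈ys (from T-∧ (qb , T-does⁺ (h b ≟ x) hb≡x))) tail

sortPair : ∀ {k} → Fin k → Fin k → Fin k × Fin k
sortPair a b = if toℕ a <ᵇ toℕ b then (a , b) else (b , a)

sortPair-< : ∀ {k} {a b : Fin k} → toℕ a < toℕ b → sortPair a b ≡ (a , b)
sortPair-< {a = a} {b} a<b with toℕ a <ᵇ toℕ b | <⇒<ᵇ a<b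
... | true | _ = refl

sortPair-> : ∀ {k} {a b : Fin k} → toℕ b < toℕ a → sortPair a b ≡ (b , a)
sortPair-> {a = a} {b} b<a with toℕ a <ᵇ toℕ b in a<ᵇb
... | false = refl
... | true  = ⊥-elim (<-asym b<a (<ᵇ⇒< (toℕ a) (toℕ b) (subst T (sym a<ᵇb) _)))

4≤ᵇ⇒≢ᵇ3 : ∀ m → T (4 ≤ᵇ m) → T (not (m ≡ᵇ 3))
4≤ᵇ⇒≢ᵇ3 (suc (suc (suc (suc m)))) _ = _

corner-bound : ∀ {A B t d} → t ≤ A → d ≤ A → d ≤ B + B → 7 ≤ A + B → t + d ≤ 3 * (A + B ∸ 4)
corner-bound {A} {B} {t} {d} t≤A d≤A d≤2B 7≤A+B = bound (B ≤? 2)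
  where
  open ≤-Reasoning
  m : ℕ
  m = A + B ∸ 4

  A+B≡4+m : A + B ≡ 4 + m
  A+B≡4+m = sym (m+[n∸m]≡n (≤-trans (s≤s (s≤s (s≤s (s≤s z≤n)))) 7≤A+B))

  3≤m : 3 ≤ m
  3≤m = ∸-monoˡ-≤ 4 7≤A+B

  bound : Dec (B ≤ 2) → t + d ≤ 3 * m
  bound (yes B≤2) = begin
    t + d        ≤⟨ +-mono-≤ t≤A d≤2B ⟩
    A + (B + B)  ≡⟨ +-assoc A B B ⟨
    A + B + B    ≡⟨ cong (_+ B) A+B≡4+m ⟩
    4 + m + B    ≤⟨ +-monoʳ-≤ (4 + m) B≤2 ⟩
    4 + m + 2    ≡⟨ +-comm (4 + m) 2 ⟩
    6 + m        ≤⟨ +-monoˡ-≤ m (+-mono-≤ 3≤m 3≤m) ⟩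
    m + m + m    ≡⟨ triple m ⟩
    3 * m        ∎
    where
    triple : ∀ m → m + m + m ≡ 3 * m
    triple = solve-∀
  bound (no B≰2) = begin
    t + d            ≤⟨ +-mono-≤ t≤A d≤A ⟩
    A + A            ≤⟨ +-mono-≤ A≤1+m A≤1+m ⟩
    1 + m + (1 + m)  ≡⟨ double m ⟩
    2 + (m + m)      ≤⟨ +-monoˡ-≤ (m + m) (≤-trans (n≤1+n 2) 3≤m) ⟩
    m + (m + m)      ≡⟨ triple m ⟩
    3 * m            ∎
    where
    A≤1+m : A ≤ 1 + m
    A≤1+m = +-cancelʳ-≤ 3 A (1 + m) (begin
      A + 3        ≤⟨ +-monoʳ-≤ A (≰⇒> B≰2) ⟩
      A + B        ≡⟨ A+B≡4+m ⟩
      3 + (1 + m)  ≡⟨ +-comm 3 (1 + m) ⟩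
      1 + m + 3    ∎)
    double : ∀ m → 1 + m + (1 + m) ≡ 2 + (m + m)
    double = solve-∀
    triple : ∀ m → m + (m + m) ≡ 3 * m
    triple = solve-∀

module _ {n} (G : PlaneGraph n) where
  open PlaneGraph G

  onTriangle : Fin n → Bool
  onTriangle x = is3face G (faceOf x)

  vertexOf-σ : ∀ x → vertexOf (σ x) ≡ vertexOf x
  vertexOf-σ x = proj₁ vertexOf-orb x 1

  faceOf-φ : ∀ x → faceOf (σ (α x)) ≡ faceOf x
  faceOf-φ x = faceOf-cf _ _ (proj₁ cfaceOf-orb x 1)

  faceOf-α : ∀ x → faceOf (α x) ≡ faceOf (σ x)
  faceOf-α x = trans (sym (faceOf-φ (α x))) (cong (faceOf ∘ σ) (αα x))

  σ-injective : ∀ {x y} → σ x ≡ σ y → x ≡ y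
  σ-injective {x} {y} e = trans (sym (σ⁻σ x)) (trans (cong σ⁻ e) (σ⁻σ y))

  α-injective : ∀ {x y} → α x ≡ α y → x ≡ y
  α-injective {x} {y} e = trans (sym (αα x)) (trans (cong α e) (αα y))

  φ-leaves-vertex : ∀ {x y} → vertexOf x ≡ vertexOf y → x ≢ σ (α y)
  φ-leaves-vertex {x} {y} e x≡φy =
    noLoop y (trans (sym (vertexOf-σ (α y))) (trans (cong vertexOf (sym x≡φy)) e))

  -- Otherwise a, b, φ a, φ b would be four distinct darts on a face of length 3.
  triangle-corner-unique : ∀ {a b} → T (onTriangle a) → faceOf a ≡ faceOf b →
                           vertexOf a ≡ vertexOf b → a ≡ b
  triangle-corner-unique {a} {b} tri fa≡fb va≡vb with a ≟ b
  ... | yes a≡b = a≡b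
  ... | no a≢b = ⊥-elim (4≰3 (subst (4 ≤_) (≡ᵇ⇒≡ (faceLen G (faceOf a)) 3 tri) four≤len))
    where
    4≰3 : ¬ 4 ≤ 3
    4≰3 (s≤s (s≤s (s≤s ())))
    distinct : Unique (a ∷ b ∷ σ (α a) ∷ σ (α b) ∷ [])
    distinct = (a≢b ∷ φ-leaves-vertex refl ∷ φ-leaves-vertex va≡vb ∷ [])
             ∷ (φ-leaves-vertex (sym va≡vb) ∷ φ-leaves-vertex refl ∷ [])
             ∷ ((a≢b ∘ α-injective ∘ σ-injective) ∷ [])
             ∷ [] ∷ []
    onFace : ∀ {y} → faceOf y ≡ faceOf a → T (faceOf y == faceOf a)
    onFace {y} = T-does⁺ (faceOf y ≟ faceOf a)
    cover : ∀ {c} → c ∈ a ∷ b ∷ σ (α a) ∷ σ (α b) ∷ [] → T true →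
            ∃[ y ] y ∈ darts G × T (faceOf y == faceOf a) × y ≡ c
    cover {c} (here refl)                 _ = c , ∈-allFin c , onFace refl , refl
    cover {c} (there (here refl))         _ = c , ∈-allFin c , onFace (sym fa≡fb) , refl
    cover {c} (there (there (here refl))) _ = c , ∈-allFin c , onFace (faceOf-φ a) , refl
    cover {c} (there (there (there (here refl)))) _ =
      c , ∈-allFin c , onFace (trans (faceOf-φ b) (sym fa≡fb)) , refl
    four≤len : 4 ≤ faceLen G (faceOf a)
    four≤len = surjection⇒count-≤ _≟_ id {p = λ _ → true} distinct cover

  edgeOnFace⇒ : ∀ {x c} → T (edgeOnFace G x c) → faceOf x ≡ c ⊎ faceOf (σ x) ≡ c
  edgeOnFace⇒ {x} = map-⊎ ==⇒≡ (trans (sym (faceOf-α x)) ∘ ==⇒≡) ∘ to T-∨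

  edgeOn4+⇒ : ∀ {x} → T (edgeOn4+ G x) → T (is4+face G (faceOf x)) ⊎ T (is4+face G (faceOf (σ x)))
  edgeOn4+⇒ {x} = map-⊎ id (subst (T ∘ is4+face G) (faceOf-α x)) ∘ to T-∨

  triangle⇒¬4+ : ∀ {f} → T (is3face G f) → ¬ T (is4+face G f)
  triangle⇒¬4+ {f} tri = subst (T ∘ (4 ≤ᵇ_)) (≡ᵇ⇒≡ (faceLen G f) 3 tri)

  edgeOn4+⇒¬triangle : ∀ {x} → T (edgeOn4+ G x) → T (onTriangle (σ x)) → T (not (onTriangle x))
  edgeOn4+⇒¬triangle {x} e4 tri with edgeOn4+⇒ e4
  ... | inj₁ 4+ = 4≤ᵇ⇒≢ᵇ3 (faceLen G (faceOf x)) 4+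
  ... | inj₂ 4+ = ⊥-elim (triangle⇒¬4+ tri 4+)

  edgeOn4+⇒¬triangle-σ : ∀ {x} → T (edgeOn4+ G x) → T (onTriangle x) → T (not (onTriangle (σ x)))
  edgeOn4+⇒¬triangle-σ {x} e4 tri with edgeOn4+⇒ e4
  ... | inj₁ 4+ = ⊥-elim (triangle⇒¬4+ tri 4+)
  ... | inj₂ 4+ = 4≤ᵇ⇒≢ᵇ3 (faceLen G (faceOf (σ x))) 4+

  EdgeProperty : (Fin n → Bool) → Set
  EdgeProperty S = ∀ x → S (α x) ≡ S x

  edgeOnFace-edge : ∀ c → EdgeProperty (λ x → edgeOnFace G x c)
  edgeOnFace-edge c x rewrite αα x = ∨-comm (faceOf (α x) == c) (faceOf x == c)

  sharedEdge-edge : ∀ f g → EdgeProperty (sharedEdge G f g)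
  sharedEdge-edge f g x = cong₂ _∧_ (edgeOnFace-edge f x) (edgeOnFace-edge g x)

  edgeOn4+-edge : EdgeProperty (edgeOn4+ G)
  edgeOn4+-edge x rewrite αα x = ∨-comm (is4+face G (faceOf (α x))) (is4+face G (faceOf x))

  edgeAtVertex⇒corner : ∀ {x u} → T (edgeAtVertex G x u) →
                        ∃[ z ] vertexOf z ≡ u × (∀ S → EdgeProperty S → S z ≡ S x)
  edgeAtVertex⇒corner {x} at with to T-∨ at
  ... | inj₁ x-at = x , ==⇒≡ x-at , λ _ _ → refl
  ... | inj₂ αx-at = α x , ==⇒≡ αx-at , λ _ S-edge → S-edge x

  diamondAt⇒corner : ∀ {f g u} → T (diamondAt G f g u) →
                     ∃[ x ] vertexOf x ≡ u × T (sharedEdge G f g x)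
  diamondAt⇒corner {f} {g} dat
    with _ , cx ← satisfied (any⁻ _ (darts G) dat)
    with sh , at ← to T-∧ cx
    with x , xu , transfer ← edgeAtVertex⇒corner at =
    x , xu , subst T (sym (transfer _ (sharedEdge-edge f g))) sh

  specialAt⇒corner : ∀ {f g u} → T (specialAt G f g u) →
                     ∃[ z ] vertexOf z ≡ u × T (edgeOnFace G z f ∨ edgeOnFace G z g)
                            × T (not (sharedEdge G f g z)) × T (edgeOn4+ G z)
  specialAt⇒corner {f} {g} spe
    with z₀ , cz ← satisfied (any⁻ _ (darts G) spe)
    with on , cz ← to T-∧ cz
    with ¬sh , cz ← to T-∧ cz
    with at , e4 ← to T-∧ cz
    with z , zu , transfer ← edgeAtVertex⇒corner at =
    z , zu , move (λ y → cong₂ _∨_ (edgeOnFace-edge f y) (edgeOnFace-edge g y)) on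
          , move (cong not ∘ sharedEdge-edge f g) ¬sh , move edgeOn4+-edge e4
    where
    move : ∀ {S} → EdgeProperty S → T (S z₀) → T (S z)
    move {S} S-edge = subst T (sym (transfer S S-edge))

  Separates : Fin n → Fin nF → Fin nF → Set
  Separates x f g = (faceOf x ≡ f × faceOf (σ x) ≡ g) ⊎ (faceOf x ≡ g × faceOf (σ x) ≡ f)

  sharedEdge⇒Separates : ∀ {x f g} → f ≢ g → T (sharedEdge G f g x) → Separates x f g
  sharedEdge⇒Separates f≢g sh with on-f , on-g ← to T-∧ sh
    with edgeOnFace⇒ on-f | edgeOnFace⇒ on-g
  ... | inj₁ p | inj₁ q = ⊥-elim (f≢g (trans (sym p) q))
  ... | inj₁ p | inj₂ q = inj₁ (p , q)
  ... | inj₂ p | inj₁ q = inj₂ (q , p)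
  ... | inj₂ p | inj₂ q = ⊥-elim (f≢g (trans (sym p) q))

  midFaces : Fin n → Fin nF × Fin nF
  midFaces x = sortPair (faceOf x) (faceOf (σ x))

  Separates⇒midFaces : ∀ {x f g} → toℕ f < toℕ g → Separates x f g → midFaces x ≡ (f , g)
  Separates⇒midFaces f<g (inj₁ (refl , refl)) = sortPair-< f<g
  Separates⇒midFaces f<g (inj₂ (refl , refl)) = sortPair-> f<g

  Separates-triangles : ∀ {x f g} → Separates x f g → T (is3face G f) → T (is3face G g) →
                        T (onTriangle x) × T (onTriangle (σ x))
  Separates-triangles (inj₁ (refl , refl)) tf tg = tf , tg
  Separates-triangles (inj₂ (refl , refl)) tf tg = tg , tf

  Separates-edgeOnFace : ∀ {x f g z} → Separates x f g → T (edgeOnFace G z f ∨ edgeOnFace G z g) →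
                         T (edgeOnFace G z (faceOf x)) ⊎ T (edgeOnFace G z (faceOf (σ x)))
  Separates-edgeOnFace (inj₁ (refl , refl)) = to T-∨
  Separates-edgeOnFace (inj₂ (refl , refl)) = swap ∘ to T-∨

  triangle-edge-at : ∀ {x z} → T (onTriangle x) → vertexOf z ≡ vertexOf x →
                     T (edgeOnFace G z (faceOf x)) → z ≡ x ⊎ σ z ≡ x
  triangle-edge-at {x} {z} tri zx on with edgeOnFace⇒ on
  ... | inj₁ fz≡fx  = inj₁ (sym (triangle-corner-unique tri (sym fz≡fx) (sym zx)))
  ... | inj₂ fσz≡fx = inj₂ (sym (triangle-corner-unique tri (sym fσz≡fx) (sym (trans (vertexOf-σ z) zx))))

  -- The edges at vertexOf x bounding the two triangles of x are those of σ⁻ x, x and σ x.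
  side-corner : ∀ {x z} → T (onTriangle x) → T (onTriangle (σ x)) → vertexOf z ≡ vertexOf x → z ≢ x →
                T (edgeOnFace G z (faceOf x)) ⊎ T (edgeOnFace G z (faceOf (σ x))) → T (edgeOn4+ G z) →
                (σ z ≡ x × T (not (onTriangle z))) ⊎ (z ≡ σ x × T (not (onTriangle (σ z))))
  side-corner {x} tx tσx zx z≢x (inj₁ on) e4 with triangle-edge-at tx zx on
  ... | inj₁ z≡x  = ⊥-elim (z≢x z≡x)
  ... | inj₂ σz≡x = inj₁ (σz≡x , edgeOn4+⇒¬triangle e4 (subst (T ∘ onTriangle) (sym σz≡x) tx))
  side-corner {x} tx tσx zx z≢x (inj₂ on) e4 with triangle-edge-at tσx (trans zx (sym (vertexOf-σ x))) on
  ... | inj₁ z≡σx  = inj₂ (z≡σx , edgeOn4+⇒¬triangle-σ e4 (subst (T ∘ onTriangle) (sym z≡σx) tσx))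
  ... | inj₂ σz≡σx = ⊥-elim (z≢x (σ-injective σz≡σx))

  module _ (v : Fin nV) where

    atV : Fin n → Bool
    atV x = vertexOf x == v

    atV⁺ : ∀ {x} → vertexOf x ≡ v → T (atV x)
    atV⁺ {x} = T-does⁺ (vertexOf x ≟ v)

    triangleCornerAt otherCornerAt : Fin n → Bool
    triangleCornerAt x = atV x ∧ onTriangle x
    otherCornerAt    x = atV x ∧ not (onTriangle x)

    triangleCorners otherCorners : ℕ
    triangleCorners = count triangleCornerAt (darts G)
    otherCorners    = count otherCornerAt (darts G)

    deg≡corners : deg G v ≡ triangleCorners + otherCorners
    deg≡corners = count-∧-split atV onTriangle (darts G)

    wt≤triangleCorners : wt G v ≤ triangleCorners
    wt≤triangleCorners = surjection⇒count-≤ _≟_ faceOf (allFin⁺ nF) cover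
      where
      cover : ∀ {f} → f ∈ allFin nF → T (is3face G f ∧ faceAtVertex G f v) →
              ∃[ x ] x ∈ darts G × T (triangleCornerAt x) × faceOf x ≡ f
      cover {f} _ c
        with tri , at ← to T-∧ c
        with x , cx ← satisfied (any⁻ _ (darts G) at)
        with fx , vx ← to T-∧ cx
        with refl ← ==⇒≡ {a = faceOf x} {f} fx = x , ∈-allFin x , from T-∧ (vx , tri) , refl

    countedDiamond : Fin nF × Fin nF → Bool
    countedDiamond (f , g) = (toℕ f <ᵇ toℕ g) ∧ isDiamond G f g ∧ diamondAt G f g v ∧ specialAt G f g v

    record CountedDiamond (f g : Fin nF) : Set where
      field
        ordered         : toℕ f < toℕ g
        f-triangle      : T (is3face G f)
        g-triangle      : T (is3face G g)
        mid             : Fin n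
        mid-at-v        : vertexOf mid ≡ v
        mid-separates   : Separates mid f g
        side            : Fin n
        side-at-v       : vertexOf side ≡ v
        side-on-diamond : T (edgeOnFace G side f ∨ edgeOnFace G side g)
        side≢mid        : side ≢ mid
        side-on-4+      : T (edgeOn4+ G side)

    countedDiamond⇒ : ∀ {f g} → T (countedDiamond (f , g)) → CountedDiamond f g
    countedDiamond⇒ {f} {g} c
      with f<g , c ← to T-∧ c
      with isd , c ← to T-∧ c
      with dat , spe ← to T-∧ c
      with tf , isd ← to T-∧ isd
      with tg , isd ← to T-∧ isd
      with f≢g , _ ← to T-∧ isd
      with x , xv , sh ← diamondAt⇒corner dat
      with z , zv , on , ¬sh , e4 ← specialAt⇒corner spe = record
        { ordered = <ᵇ⇒< (toℕ f) (toℕ g) f<g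
        ; f-triangle = tf ; g-triangle = tg
        ; mid = x ; mid-at-v = xv
        ; mid-separates = sharedEdge⇒Separates (T-not-does⁻ (f ≟ g) f≢g) sh
        ; side = z ; side-at-v = zv ; side-on-diamond = on
        ; side≢mid = λ { refl → subst T (to T-not-≡ ¬sh) sh }
        ; side-on-4+ = e4 }

    facePairs-unique : Unique (cartesianProduct (allFin nF) (allFin nF))
    facePairs-unique = cartesianProduct⁺ (allFin⁺ nF) (allFin⁺ nF)

    wd≤triangleCorners : wd G v ≤ triangleCorners
    wd≤triangleCorners =
      surjection⇒count-≤ (≡-dec _≟_ _≟_) midFaces {p = countedDiamond} facePairs-unique cover
      where
      cover : ∀ {fg} → fg ∈ cartesianProduct (allFin nF) (allFin nF) → T (countedDiamond fg) →
              ∃[ x ] x ∈ darts G × T (triangleCornerAt x) × midFaces x ≡ fg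
      cover {f , g} _ c = mid , ∈-allFin mid
                , from T-∧ (atV⁺ mid-at-v , proj₁ (Separates-triangles mid-separates f-triangle g-triangle))
                , Separates⇒midFaces ordered mid-separates
        where open CountedDiamond (countedDiamond⇒ {f} {g} c)

    -- inj₁ y pays for the diamond with mid-edge σ y, inj₂ y for the one with mid-edge σ⁻ (σ⁻ y).
    wd≤2otherCorners : wd G v ≤ otherCorners + otherCorners
    wd≤2otherCorners = begin
      wd G v
        ≤⟨ surjection⇒count-≤ (≡-dec _≟_ _≟_) charge {p = countedDiamond} facePairs-unique cover ⟩
      count otherCornerAt⊎ (map inj₁ (darts G) ++ map inj₂ (darts G))
        ≡⟨ count-++ otherCornerAt⊎ (map inj₁ (darts G)) (map inj₂ (darts G)) ⟩
      count otherCornerAt⊎ (map inj₁ (darts G)) + count otherCornerAt⊎ (map inj₂ (darts G))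
        ≡⟨ cong₂ _+_ (count-map otherCornerAt⊎ inj₁ (darts G)) (count-map otherCornerAt⊎ inj₂ (darts G)) ⟩
      otherCorners + otherCorners
        ∎
      where
      open ≤-Reasoning
      otherCornerAt⊎ : Fin n ⊎ Fin n → Bool
      otherCornerAt⊎ = [ otherCornerAt , otherCornerAt ]
      charge : Fin n ⊎ Fin n → Fin nF × Fin nF
      charge = [ midFaces ∘ σ , midFaces ∘ σ⁻ ∘ σ⁻ ]
      cover : ∀ {fg} → fg ∈ cartesianProduct (allFin nF) (allFin nF) → T (countedDiamond fg) →
              ∃[ y ] y ∈ map inj₁ (darts G) ++ map inj₂ (darts G) × T (otherCornerAt⊎ y) × charge y ≡ fg
      cover {f , g} _ c = charged (side-corner (proj₁ triangles) (proj₂ triangles)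
                                    (trans side-at-v (sym mid-at-v)) side≢mid
                                    (Separates-edgeOnFace mid-separates side-on-diamond) side-on-4+)
        where
        open CountedDiamond (countedDiamond⇒ {f} {g} c)
        triangles : T (onTriangle mid) × T (onTriangle (σ mid))
        triangles = Separates-triangles mid-separates f-triangle g-triangle
        sorted : midFaces mid ≡ (f , g)
        sorted = Separates⇒midFaces ordered mid-separates
        charged : (σ side ≡ mid × T (not (onTriangle side))) ⊎ (side ≡ σ mid × T (not (onTriangle (σ side)))) →
                  ∃[ y ] y ∈ map inj₁ (darts G) ++ map inj₂ (darts G) × T (otherCornerAt⊎ y) × charge y ≡ (f , g)
        charged (inj₁ (σz≡x , ¬tri)) =
          inj₁ side , ∈-++⁺ˡ (∈-map⁺ inj₁ (∈-allFin side)) , from T-∧ (atV⁺ side-at-v , ¬tri)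
          , trans (cong midFaces σz≡x) sorted
        charged (inj₂ (z≡σx , ¬tri)) =
          inj₂ (σ side) , ∈-++⁺ʳ (map inj₁ (darts G)) (∈-map⁺ inj₂ (∈-allFin (σ side)))
          , from T-∧ (atV⁺ (trans (vertexOf-σ side) side-at-v) , ¬tri)
          , trans (cong midFaces σ⁻σ⁻σz≡x) sorted
          where
          σ⁻σ⁻σz≡x : σ⁻ (σ⁻ (σ side)) ≡ mid
          σ⁻σ⁻σz≡x = trans (cong σ⁻ (trans (σ⁻σ side) z≡σx)) (σ⁻σ mid)

lemma4 : ∀ {n} (G : PlaneGraph n) (v : Fin (PlaneGraph.nV G)) →
           7 ≤ deg G v → w G v ≤ 3 * (deg G v ∸ 4)
lemma4 G v 7≤deg with deg G v | deg≡corners G v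
... | _ | refl =
  corner-bound (wt≤triangleCorners G v) (wd≤triangleCorners G v) (wd≤2otherCorners G v) 7≤deg
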